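{- Let $\alpha,\beta>0$ be real numbers with $\alpha\ge\beta$, $\beta\le1$ and $\alpha+\beta\ge1$. Let $u(1)=1$ and $$u(n)=\max_{1\le k\le\lfloor n/2\rfloor}\{\alpha u(k)+\beta u(n-k)\}\qquad(n\ge2).$$ Then for every $n\ge2$ the maximum is attained at $k=\lfloor n/2\rfloor$; hence $u(n)=\alpha u(\lfloor n/2\rfloor)+\beta u(\lceil n/2\rceil)$ for $n\ge2$, and $u(n)=S_{\alpha,\beta}(n)$ for all $n\ge1$.
   Context: $S_{\alpha,\beta}(n)$ denotes the sequence defined by $S_{\alpha,\beta}(1)=1$ and $S_{\alpha,\beta}(n)=\alpha S_{\alpha,\beta}(\lfloor n/2\rfloor)+\beta S_{\alpha,\beta}(\lceil n/2\rceil)$ for $n\ge2$. -}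

module Defs where

open import Level using (Level; suc; _⊔_)
open import Algebra.Bundles using (CommutativeRing)
open import Relation.Binary.Core using (Rel)
open import Relation.Binary.Structures using (IsTotalOrder)
open import Relation.Nullary using (¬_)
open import Data.Product using (_×_)
import Data.Nat as ℕ
open ℕ using (ℕ; zero; _∸_; ⌊_/2⌋; ⌈_/2⌉)

-- A (totally) ordered commutative ring: the abstract setting in which the
-- real-number statement is formulated (ℝ is an instance; agda-stdlib has no ℝ).
record OrderedCommutativeRing (c ℓ₁ ℓ₂ : Level) : Set (suc (c ⊔ ℓ₁ ⊔ ℓ₂)) where
  field
    commutativeRing : CommutativeRing c ℓ₁
  open CommutativeRing commutativeRing public
  field
    _≤_          : Rel Carrier ℓ₂
    isTotalOrder : IsTotalOrder _≈_ _≤_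
    +-monoˡ-≤    : ∀ {x y} z → x ≤ y → (x + z) ≤ (y + z)
    *-nonneg     : ∀ {x y} → 0# ≤ x → 0# ≤ y → 0# ≤ (x * y)

  _<_ : Rel Carrier (ℓ₁ ⊔ ℓ₂)
  x < y = (x ≤ y) × ¬ (x ≈ y)

module _ {c ℓ₁ ℓ₂} (R : OrderedCommutativeRing c ℓ₁ ℓ₂) where
  open OrderedCommutativeRing R

  -- S_{α,β}(n) with S(1) = 1 and S(n) = α S(⌊n/2⌋) + β S(⌈n/2⌉) for n ≥ 2,
  -- computed with a fuel argument (fuel ≥ n suffices); S(0) is irrelevant (set to 0).
  S-fuel : Carrier → Carrier → ℕ → ℕ → Carrier
  S-fuel α β zero    n               = 0#
  S-fuel α β (ℕ.suc f) zero          = 0#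
  S-fuel α β (ℕ.suc f) (ℕ.suc zero)  = 1#
  S-fuel α β (ℕ.suc f) n@(ℕ.suc (ℕ.suc _)) =
    (α * S-fuel α β f ⌊ n /2⌋) + (β * S-fuel α β f ⌈ n /2⌉)

  S : Carrier → Carrier → ℕ → Carrier
  S α β n = S-fuel α β n n

{-# OPTIONS --safe #-}
-- Write σ = S_{α,β}. The heart of the matter is superadditivity: α σ(k) + β σ(l) ≤ σ(k + l)
-- for 1 ≤ k ≤ l. Expanding σ(k) and σ(l) into their halves and regrouping, the induction
-- hypothesis bounds the left side by α σ(s) + β σ(t) with s = ⌊k/2⌋ + ⌊l/2⌋ and
-- t = ⌈k/2⌉ + ⌈l/2⌉. Now s + t = k + l and s ≤ t ≤ s + 2; for t ≤ s + 1 the bound is the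
-- recursion for σ(s + t) itself, and for t = s + 2 it is the concavity estimate
-- α σ(s) + β σ(s+2) ≤ (α + β) σ(s+1). Concavity, monotonicity of σ and the case k = 1 follow
-- by recursion on the binary expansion, using β ≤ α, β ≤ 1 ≤ α + β.
-- If u agrees with σ below n, superadditivity bounds every candidate α u(k) + β u(n - k) by
-- σ(n), and k = ⌊n/2⌋ attains σ(n); hence u = σ by strong induction.
module Submission where

open import Defs
open import Data.Nat as ℕ using (ℕ; zero; suc; _≤_; _∸_; ⌊_/2⌋; ⌈_/2⌉; z≤n; s≤s)
import Data.Nat.Properties as ℕₚ
open import Data.Nat.Induction using (<-rec)
open import Data.Product using (_×_; Σ; _,_; proj₁)
open import Data.Sum using (inj₁; inj₂)
open import Relation.Binary.PropositionalEquality as ≡ using (_≡_; cong; subst)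
open import Relation.Binary.Bundles using (Poset)
open import Relation.Binary.Structures using (IsTotalOrder)
import Algebra.Properties.CommutativeSemigroup as CommutativeSemigroupProperties
import Algebra.Properties.Group as GroupProperties
import Algebra.Solver.Ring.NaturalCoefficients.Default as RingSolver
import Relation.Binary.Reasoning.PartialOrder as PosetReasoning

data Positive : ℕ → Set where
  one     : Positive 1
  twice   : ∀ {m} → Positive m → Positive (m ℕ.+ m)
  twice+1 : ∀ {m} → Positive m → Positive (suc (m ℕ.+ m))

suc-+-suc : ∀ m → suc m ℕ.+ suc m ≡ suc (suc (m ℕ.+ m))
suc-+-suc m = cong suc (ℕₚ.+-suc m m)

Positive-suc : ∀ {n} → Positive n → Positive (suc n)
Positive-suc one             = twice one
Positive-suc (twice p)       = twice+1 p
Positive-suc (twice+1 {m} p) = subst Positive (suc-+-suc m) (twice (Positive-suc p))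

positive : ∀ {n} → 1 ≤ n → Positive n
positive {suc zero}    _ = one
positive {suc (suc n)} _ = Positive-suc (positive {suc n} (s≤s z≤n))

Positive⇒1≤ : ∀ {n} → Positive n → 1 ≤ n
Positive⇒1≤ one         = s≤s z≤n
Positive⇒1≤ (twice p)   = ℕₚ.≤-trans (Positive⇒1≤ p) (ℕₚ.m≤m+n _ _)
Positive⇒1≤ (twice+1 p) = s≤s z≤n

⌈n/2⌉≤1+⌊n/2⌋ : ∀ n → ⌈ n /2⌉ ≤ suc ⌊ n /2⌋
⌈n/2⌉≤1+⌊n/2⌋ n = ℕₚ.⌊n/2⌋-mono (ℕₚ.n≤1+n (suc n))

n∸⌊n/2⌋≡⌈n/2⌉ : ∀ n → n ∸ ⌊ n /2⌋ ≡ ⌈ n /2⌉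
n∸⌊n/2⌋≡⌈n/2⌉ n = ≡.trans (cong (_∸ ⌊ n /2⌋) (≡.sym (ℕₚ.⌊n/2⌋+⌈n/2⌉≡n n)))
                          (ℕₚ.m+n∸m≡n ⌊ n /2⌋ ⌈ n /2⌉)

halves-sum : ∀ m n → (⌊ m /2⌋ ℕ.+ ⌊ n /2⌋) ℕ.+ (⌈ m /2⌉ ℕ.+ ⌈ n /2⌉) ≡ m ℕ.+ n
halves-sum m n =
  ≡.trans (CommutativeSemigroupProperties.interchange ℕₚ.+-commutativeSemigroup ⌊ m /2⌋ ⌊ n /2⌋ ⌈ m /2⌉ ⌈ n /2⌉)
          (≡.cong₂ ℕ._+_ (ℕₚ.⌊n/2⌋+⌈n/2⌉≡n m) (ℕₚ.⌊n/2⌋+⌈n/2⌉≡n n))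

⌊⌋-sum≤⌈⌉-sum : ∀ m n → ⌊ m /2⌋ ℕ.+ ⌊ n /2⌋ ≤ ⌈ m /2⌉ ℕ.+ ⌈ n /2⌉
⌊⌋-sum≤⌈⌉-sum m n = ℕₚ.+-mono-≤ (ℕₚ.⌊n/2⌋≤⌈n/2⌉ m) (ℕₚ.⌊n/2⌋≤⌈n/2⌉ n)

⌈⌉-sum≤2+⌊⌋-sum : ∀ m n → ⌈ m /2⌉ ℕ.+ ⌈ n /2⌉ ≤ 2 ℕ.+ (⌊ m /2⌋ ℕ.+ ⌊ n /2⌋)
⌈⌉-sum≤2+⌊⌋-sum m n = subst (⌈ m /2⌉ ℕ.+ ⌈ n /2⌉ ≤_) (cong suc (ℕₚ.+-suc ⌊ m /2⌋ ⌊ n /2⌋))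
  (ℕₚ.+-mono-≤ (⌈n/2⌉≤1+⌊n/2⌋ m) (⌈n/2⌉≤1+⌊n/2⌋ n))

m≤⌊n/2⌋⇒m≤n∸m : ∀ {m n} → m ≤ ⌊ n /2⌋ → m ≤ n ∸ m
m≤⌊n/2⌋⇒m≤n∸m {m} {n} m≤⌊n/2⌋ = begin
  m            ≤⟨ m≤⌊n/2⌋ ⟩
  ⌊ n /2⌋      ≤⟨ ℕₚ.⌊n/2⌋≤⌈n/2⌉ n ⟩
  ⌈ n /2⌉      ≡⟨ n∸⌊n/2⌋≡⌈n/2⌉ n ⟨
  n ∸ ⌊ n /2⌋  ≤⟨ ℕₚ.∸-monoʳ-≤ n m≤⌊n/2⌋ ⟩
  n ∸ m        ∎
  where open ℕₚ.≤-Reasoning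

module OrderedCommutativeRingProperties {c ℓ₁ ℓ₂} (R : OrderedCommutativeRing c ℓ₁ ℓ₂) where
  open OrderedCommutativeRing R hiding (zero) renaming (_≤_ to infix 4 _≤R_)
  module ≤R = IsTotalOrder isTotalOrder
  open GroupProperties +-group using (//-rightDividesˡ; //-rightDividesʳ)

  poset : Poset c ℓ₁ ℓ₂
  poset = record { isPartialOrder = ≤R.isPartialOrder }

  open PosetReasoning poset

  +-monoʳ-≤ : ∀ z {x y} → x ≤R y → z + x ≤R z + y
  +-monoʳ-≤ z {x} {y} x≤y = begin
    z + x  ≈⟨ +-comm z x ⟩
    x + z  ≤⟨ +-monoˡ-≤ z x≤y ⟩
    y + z  ≈⟨ +-comm y z ⟩
    z + y  ∎

  +-mono-≤ : ∀ {x y u v} → x ≤R y → u ≤R v → x + u ≤R y + v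
  +-mono-≤ {y = y} {u} x≤y u≤v = ≤R.trans (+-monoˡ-≤ u x≤y) (+-monoʳ-≤ y u≤v)

  +-cancelʳ-≤ : ∀ z {x y} → x + z ≤R y + z → x ≤R y
  +-cancelʳ-≤ z {x} {y} x+z≤y+z = begin
    x            ≈⟨ //-rightDividesʳ z x ⟨
    x + z - z    ≤⟨ +-monoˡ-≤ (- z) x+z≤y+z ⟩
    y + z - z    ≈⟨ //-rightDividesʳ z y ⟩
    y            ∎

  x≤x+nonneg : ∀ x {w} → 0# ≤R w → x ≤R x + w
  x≤x+nonneg x {w} 0≤w = begin
    x       ≈⟨ +-identityʳ x ⟨
    x + 0#  ≤⟨ +-monoʳ-≤ x 0≤w ⟩
    x + w   ∎

  ≤⇒nonneg-gap : ∀ {x y} → x ≤R y → Σ Carrier λ w → 0# ≤R w × y ≈ x + w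
  ≤⇒nonneg-gap {x} {y} x≤y = y - x , 0≤y-x , y≈x+[y-x]
    where
    0≤y-x : 0# ≤R y - x
    0≤y-x = begin
      0#      ≈⟨ -‿inverseʳ x ⟨
      x - x   ≤⟨ +-monoˡ-≤ (- x) x≤y ⟩
      y - x   ∎
    y≈x+[y-x] : y ≈ x + (y - x)
    y≈x+[y-x] = trans (sym (//-rightDividesˡ x y)) (+-comm (y - x) x)

  *-monoˡ-≤-nonneg : ∀ {z x y} → 0# ≤R z → x ≤R y → z * x ≤R z * y
  *-monoˡ-≤-nonneg {z} {x} {y} 0≤z x≤y with ≤⇒nonneg-gap x≤y
  ... | w , 0≤w , y≈x+w = begin
    z * x            ≤⟨ x≤x+nonneg (z * x) (*-nonneg 0≤z 0≤w) ⟩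
    z * x + z * w    ≈⟨ distribˡ z x w ⟨
    z * (x + w)      ≈⟨ *-congˡ y≈x+w ⟨
    z * y            ∎

  -- (v - u) (y - x) ≥ 0, written without subtraction.
  rearrangement : ∀ {u v x y} → u ≤R v → x ≤R y → u * y + v * x ≤R u * x + v * y
  rearrangement {u} {v} {x} {y} u≤v x≤y with ≤⇒nonneg-gap u≤v
  ... | w , 0≤w , v≈u+w = begin
    u * y + v * x              ≈⟨ +-congˡ (*-congʳ v≈u+w) ⟩
    u * y + (u + w) * x        ≈⟨ expandˡ u w x y ⟩
    (u * x + u * y) + w * x    ≤⟨ +-monoʳ-≤ (u * x + u * y) (*-monoˡ-≤-nonneg 0≤w x≤y) ⟩
    (u * x + u * y) + w * y    ≈⟨ expandʳ u w x y ⟨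
    u * x + (u + w) * y        ≈⟨ +-congˡ (*-congʳ v≈u+w) ⟨
    u * x + v * y              ∎
    where
    open RingSolver commutativeSemiring
    expandˡ : ∀ u w x y → u * y + (u + w) * x ≈ (u * x + u * y) + w * x
    expandˡ = solve 4 (λ u w x y → u :* y :+ (u :+ w) :* x := (u :* x :+ u :* y) :+ w :* x) refl
    expandʳ : ∀ u w x y → u * x + (u + w) * y ≈ (u * x + u * y) + w * y
    expandʳ = solve 4 (λ u w x y → u :* x :+ (u :+ w) :* y := (u :* x :+ u :* y) :+ w :* y) refl

  weighted-interchange : ∀ a b x₁ x₂ y₁ y₂ →
    a * (a * x₁ + b * x₂) + b * (a * y₁ + b * y₂) ≈ a * (a * x₁ + b * y₁) + b * (a * x₂ + b * y₂)
  weighted-interchange = solve 6 (λ a b x₁ x₂ y₁ y₂ →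
    a :* (a :* x₁ :+ b :* x₂) :+ b :* (a :* y₁ :+ b :* y₂) := a :* (a :* x₁ :+ b :* y₁) :+ b :* (a :* x₂ :+ b :* y₂)) refl
    where open RingSolver commutativeSemiring

module SRecurrence {c ℓ₁ ℓ₂} (R : OrderedCommutativeRing c ℓ₁ ℓ₂) (α β : OrderedCommutativeRing.Carrier R) where
  open OrderedCommutativeRing R hiding (zero; _<_) renaming (_≤_ to infix 4 _≤R_)
  open import Data.Nat using (_<_)
  open OrderedCommutativeRingProperties R
  open PosetReasoning poset

  σ : ℕ → Carrier
  σ = S R α β

  σ-cong : ∀ {m n} → m ≡ n → σ m ≈ σ n
  σ-cong m≡n = reflexive (cong σ m≡n)

  S-fuel-irrelevant : ∀ f g n → n ≤ f → n ≤ g → S-fuel R α β f n ≡ S-fuel R α β g n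
  S-fuel-irrelevant zero          zero          zero          _ _ = ≡.refl
  S-fuel-irrelevant zero          (suc g)       zero          _ _ = ≡.refl
  S-fuel-irrelevant (suc f)       zero          zero          _ _ = ≡.refl
  S-fuel-irrelevant (suc f)       (suc g)       zero          _ _ = ≡.refl
  S-fuel-irrelevant (suc f)       (suc g)       (suc zero)    _ _ = ≡.refl
  S-fuel-irrelevant (suc f)       (suc g)       (suc (suc n)) (s≤s n<f) (s≤s n<g) =
    ≡.cong₂ (λ x y → α * x + β * y)
      (S-fuel-irrelevant f g _ (ℕₚ.≤-trans ⌊⌋≤ n<f) (ℕₚ.≤-trans ⌊⌋≤ n<g))
      (S-fuel-irrelevant f g _ (ℕₚ.≤-trans ⌈⌉≤ n<f) (ℕₚ.≤-trans ⌈⌉≤ n<g))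
    where
    ⌊⌋≤ : ⌊ suc (suc n) /2⌋ ≤ suc n
    ⌊⌋≤ = s≤s (ℕₚ.⌊n/2⌋≤n n)
    ⌈⌉≤ : ⌈ suc (suc n) /2⌉ ≤ suc n
    ⌈⌉≤ = ℕₚ.⌊n/2⌋<n n

  σ-halves : ∀ {n} → 2 ≤ n → σ n ≈ α * σ ⌊ n /2⌋ + β * σ ⌈ n /2⌉
  σ-halves {suc zero}    (s≤s ())
  σ-halves {suc (suc n)} _ = reflexive (≡.cong₂ (λ x y → α * x + β * y)
    (S-fuel-irrelevant _ _ _ (s≤s (ℕₚ.⌊n/2⌋≤n n)) ℕₚ.≤-refl)
    (S-fuel-irrelevant _ _ _ (ℕₚ.⌊n/2⌋<n n) ℕₚ.≤-refl))

  σ-even : ∀ {m} → Positive m → σ (m ℕ.+ m) ≈ α * σ m + β * σ m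
  σ-even {m} p = trans (σ-halves (ℕₚ.+-mono-≤ 1≤m 1≤m))
    (+-cong (*-congˡ (σ-cong (≡.sym (ℕₚ.n≡⌊n+n/2⌋ m)))) (*-congˡ (σ-cong (≡.sym (ℕₚ.n≡⌈n+n/2⌉ m)))))
    where
    1≤m : 1 ≤ m
    1≤m = Positive⇒1≤ p

  σ-odd : ∀ {m} → Positive m → σ (suc (m ℕ.+ m)) ≈ α * σ m + β * σ (suc m)
  σ-odd {m} p = trans (σ-halves (s≤s (ℕₚ.≤-trans (Positive⇒1≤ p) (ℕₚ.m≤m+n m m))))
    (+-cong (*-congˡ (σ-cong (≡.sym (ℕₚ.n≡⌈n+n/2⌉ m)))) (*-congˡ (σ-cong (cong suc (≡.sym (ℕₚ.n≡⌊n+n/2⌋ m))))))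

  σ-even-suc : ∀ {m} → Positive m → σ (2 ℕ.+ (m ℕ.+ m)) ≈ α * σ (suc m) + β * σ (suc m)
  σ-even-suc {m} p = trans (σ-cong (≡.sym (suc-+-suc m))) (σ-even (Positive-suc p))

  σ-odd-suc : ∀ {m} → Positive m → σ (3 ℕ.+ (m ℕ.+ m)) ≈ α * σ (suc m) + β * σ (2 ℕ.+ m)
  σ-odd-suc {m} p = trans (σ-cong (cong suc (≡.sym (suc-+-suc m)))) (σ-odd (Positive-suc p))

  module Inequalities (0≤α : 0# ≤R α) (0≤β : 0# ≤R β) (β≤α : β ≤R α) (β≤1 : β ≤R 1#) (1≤α+β : 1# ≤R α + β) where
    open RingSolver commutativeSemiring using (solve; _:=_; _:+_; _:*_; con)

    σ-mono : ∀ {n} → Positive n → σ n ≤R σ (suc n)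
    σ-mono one = begin
      1#                   ≤⟨ 1≤α+β ⟩
      α + β                ≈⟨ +-cong (*-identityʳ α) (*-identityʳ β) ⟨
      α * σ 1 + β * σ 1    ∎
    σ-mono (twice {m} p) = begin
      σ (m ℕ.+ m)              ≈⟨ σ-even p ⟩
      α * σ m + β * σ m        ≤⟨ +-monoʳ-≤ (α * σ m) (*-monoˡ-≤-nonneg 0≤β (σ-mono p)) ⟩
      α * σ m + β * σ (suc m)  ≈⟨ σ-odd p ⟨
      σ (suc (m ℕ.+ m))        ∎
    σ-mono (twice+1 {m} p) = begin
      σ (suc (m ℕ.+ m))              ≈⟨ σ-odd p ⟩
      α * σ m + β * σ (suc m)        ≤⟨ +-monoˡ-≤ (β * σ (suc m)) (*-monoˡ-≤-nonneg 0≤α (σ-mono p)) ⟩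
      α * σ (suc m) + β * σ (suc m)  ≈⟨ σ-even-suc p ⟨
      σ (2 ℕ.+ (m ℕ.+ m))            ∎

    1≤σ : ∀ {n} → 1 ≤ n → 1# ≤R σ n
    1≤σ {suc zero}    _ = ≤R.refl
    1≤σ {suc (suc n)} _ = ≤R.trans (1≤σ {suc n} (s≤s z≤n)) (σ-mono (positive {suc n} (s≤s z≤n)))

    σ-concave : ∀ {k} → Positive k → α * σ k + β * σ (2 ℕ.+ k) ≤R α * σ (1 ℕ.+ k) + β * σ (1 ℕ.+ k)
    σ-concave one = begin
      α * 1# + β * (α * 1# + β * (α * 1# + β * 1#))  ≈⟨ expand α β ⟩
      ((β * β) * (α + β) + α * 1#) + α * β           ≤⟨ +-monoˡ-≤ (α * β) (rearrangement β²≤α 1≤α+β) ⟩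
      ((β * β) * 1# + α * (α + β)) + α * β           ≈⟨ collect α β ⟩
      α * (α * 1# + β * 1#) + β * (α * 1# + β * 1#)  ∎
      where
      β²≤α : β * β ≤R α
      β²≤α = ≤R.trans (≤R.trans (*-monoˡ-≤-nonneg 0≤β β≤1) (≤R.reflexive (*-identityʳ β))) β≤α
      expand : ∀ a b → a * 1# + b * (a * 1# + b * (a * 1# + b * 1#)) ≈ ((b * b) * (a + b) + a * 1#) + a * b
      expand = solve 2 (λ a b → a :* con 1 :+ b :* (a :* con 1 :+ b :* (a :* con 1 :+ b :* con 1))
                                := ((b :* b) :* (a :+ b) :+ a :* con 1) :+ a :* b) refl
      collect : ∀ a b → ((b * b) * 1# + a * (a + b)) + a * b ≈ a * (a * 1# + b * 1#) + b * (a * 1# + b * 1#)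
      collect = solve 2 (λ a b → ((b :* b) :* con 1 :+ a :* (a :+ b)) :+ a :* b
                                 := a :* (a :* con 1 :+ b :* con 1) :+ b :* (a :* con 1 :+ b :* con 1)) refl
    σ-concave (twice {m} p) = begin
      α * σ (m ℕ.+ m) + β * σ (2 ℕ.+ (m ℕ.+ m))
        ≈⟨ +-cong (*-congˡ (σ-even p)) (*-congˡ (σ-even-suc p)) ⟩
      α * (α * σ m + β * σ m) + β * (α * σ (suc m) + β * σ (suc m))
        ≈⟨ weighted-interchange α β _ _ _ _ ⟩
      α * (α * σ m + β * σ (suc m)) + β * (α * σ m + β * σ (suc m))
        ≈⟨ +-cong (*-congˡ (σ-odd p)) (*-congˡ (σ-odd p)) ⟨
      α * σ (suc (m ℕ.+ m)) + β * σ (suc (m ℕ.+ m))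
        ∎
    -- α times concavity at m, plus (αβ - β²)(σ(m+2) - σ(m+1)) ≥ 0; both sides are shifted by
    -- αβ σ(m+2) to keep everything subtraction-free.
    σ-concave (twice+1 {m} p) = +-cancelʳ-≤ (α * β * Z) (begin
      α * σ (suc (m ℕ.+ m)) + β * σ (3 ℕ.+ (m ℕ.+ m)) + α * β * Z
        ≈⟨ +-congʳ (+-cong (*-congˡ (σ-odd p)) (*-congˡ (σ-odd-suc p))) ⟩
      α * (α * X + β * Y) + β * (α * Y + β * Z) + α * β * Z
        ≈⟨ expand α β X Y Z ⟩
      α * (α * X + β * Z) + (β * β * Z + α * β * Y) + α * β * Y
        ≤⟨ +-monoˡ-≤ (α * β * Y) (+-mono-≤ (*-monoˡ-≤-nonneg 0≤α (σ-concave p))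
                                           (rearrangement β²≤αβ (σ-mono (Positive-suc p)))) ⟩
      α * (α * Y + β * Y) + (β * β * Y + α * β * Z) + α * β * Y
        ≈⟨ collect α β Y Z ⟩
      α * (α * Y + β * Y) + β * (α * Y + β * Y) + α * β * Z
        ≈⟨ +-congʳ (+-cong (*-congˡ (σ-even-suc p)) (*-congˡ (σ-even-suc p))) ⟨
      α * σ (2 ℕ.+ (m ℕ.+ m)) + β * σ (2 ℕ.+ (m ℕ.+ m)) + α * β * Z
        ∎)
      where
      X Y Z : Carrier
      X = σ m
      Y = σ (1 ℕ.+ m)
      Z = σ (2 ℕ.+ m)
      β²≤αβ : β * β ≤R α * β
      β²≤αβ = ≤R.trans (*-monoˡ-≤-nonneg 0≤β β≤α) (≤R.reflexive (*-comm β α))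
      expand : ∀ a b x y z → a * (a * x + b * y) + b * (a * y + b * z) + a * b * z
                             ≈ a * (a * x + b * z) + (b * b * z + a * b * y) + a * b * y
      expand = solve 5 (λ a b x y z → a :* (a :* x :+ b :* y) :+ b :* (a :* y :+ b :* z) :+ a :* b :* z
                                      := a :* (a :* x :+ b :* z) :+ (b :* b :* z :+ a :* b :* y) :+ a :* b :* y) refl
      collect : ∀ a b y z → a * (a * y + b * y) + (b * b * y + a * b * z) + a * b * y
                            ≈ a * (a * y + b * y) + b * (a * y + b * y) + a * b * z
      collect = solve 4 (λ a b y z → a :* (a :* y :+ b :* y) :+ (b :* b :* y :+ a :* b :* z) :+ a :* b :* y
                                     := a :* (a :* y :+ b :* y) :+ b :* (a :* y :+ b :* y) :+ a :* b :* z) refl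

    σ-superadditive-1 : ∀ {l} → Positive l → α * σ 1 + β * σ l ≤R σ (1 ℕ.+ l)
    σ-superadditive-1 one = ≤R.refl
    σ-superadditive-1 (twice {m} p) = +-cancelʳ-≤ (α * β) (begin
      α * 1# + β * σ (m ℕ.+ m) + α * β
        ≈⟨ +-congʳ (+-congˡ (*-congˡ (σ-even p))) ⟩
      α * 1# + β * (α * X + β * X) + α * β
        ≈⟨ expand α β X ⟩
      β * (α * 1# + β * X) + α * (β * X + 1# * 1#)
        ≤⟨ +-mono-≤ (*-monoˡ-≤-nonneg 0≤β (σ-superadditive-1 p))
                    (*-monoˡ-≤-nonneg 0≤α (rearrangement β≤1 (1≤σ (Positive⇒1≤ p)))) ⟩
      β * Y + α * (β * 1# + 1# * X)
        ≈⟨ collect α β X Y ⟩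
      α * X + β * Y + α * β
        ≈⟨ +-congʳ (σ-odd p) ⟨
      σ (suc (m ℕ.+ m)) + α * β
        ∎)
      where
      X Y : Carrier
      X = σ m
      Y = σ (1 ℕ.+ m)
      expand : ∀ a b x → a * 1# + b * (a * x + b * x) + a * b ≈ b * (a * 1# + b * x) + a * (b * x + 1# * 1#)
      expand = solve 3 (λ a b x → a :* con 1 :+ b :* (a :* x :+ b :* x) :+ a :* b
                                  := b :* (a :* con 1 :+ b :* x) :+ a :* (b :* x :+ con 1 :* con 1)) refl
      collect : ∀ a b x y → b * y + a * (b * 1# + 1# * x) ≈ a * x + b * y + a * b
      collect = solve 4 (λ a b x y → b :* y :+ a :* (b :* con 1 :+ con 1 :* x) := a :* x :+ b :* y :+ a :* b) refl
    -- α times the case m, β (1 - β)(σ(m+1) - 1) ≥ 0 and (α - β)(α + β - 1) ≥ 0; the shift W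
    -- keeps both sides subtraction-free.
    σ-superadditive-1 (twice+1 {m} p) = +-cancelʳ-≤ W (begin
      α * 1# + β * σ (suc (m ℕ.+ m)) + W
        ≈⟨ +-congʳ (+-congˡ (*-congˡ (σ-odd p))) ⟩
      α * 1# + β * (α * X + β * Y) + W
        ≈⟨ expand α β X Y ⟩
      α * (α * 1# + β * X) + β * (β * Y + 1# * 1#) + (β * (α + β) + α * 1#)
        ≤⟨ +-mono-≤ (+-mono-≤ (*-monoˡ-≤-nonneg 0≤α (σ-superadditive-1 p))
                              (*-monoˡ-≤-nonneg 0≤β (rearrangement β≤1 (1≤σ {suc m} (s≤s z≤n)))))
                    (rearrangement β≤α 1≤α+β) ⟩
      α * Y + β * (β * 1# + 1# * Y) + (β * 1# + α * (α + β))
        ≈⟨ collect α β Y ⟩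
      α * Y + β * Y + W
        ≈⟨ +-congʳ (σ-even-suc p) ⟨
      σ (2 ℕ.+ (m ℕ.+ m)) + W
        ∎)
      where
      X Y W : Carrier
      X = σ m
      Y = σ (1 ℕ.+ m)
      W = α * α + β + α * β + β * β
      expand : ∀ a b x y → a * 1# + b * (a * x + b * y) + (a * a + b + a * b + b * b)
                           ≈ a * (a * 1# + b * x) + b * (b * y + 1# * 1#) + (b * (a + b) + a * 1#)
      expand = solve 4 (λ a b x y → a :* con 1 :+ b :* (a :* x :+ b :* y) :+ (a :* a :+ b :+ a :* b :+ b :* b)
                                    := a :* (a :* con 1 :+ b :* x) :+ b :* (b :* y :+ con 1 :* con 1)
                                       :+ (b :* (a :+ b) :+ a :* con 1)) refl
      collect : ∀ a b y → a * y + b * (b * 1# + 1# * y) + (b * 1# + a * (a + b))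
                          ≈ a * y + b * y + (a * a + b + a * b + b * b)
      collect = solve 3 (λ a b y → a :* y :+ b :* (b :* con 1 :+ con 1 :* y) :+ (b :* con 1 :+ a :* (a :+ b))
                                   := a :* y :+ b :* y :+ (a :* a :+ b :+ a :* b :+ b :* b)) refl

    weighted-interchange-≤ : ∀ {x₁ x₂ y₁ y₂ s t} → α * x₁ + β * y₁ ≤R s → α * x₂ + β * y₂ ≤R t →
                             α * (α * x₁ + β * x₂) + β * (α * y₁ + β * y₂) ≤R α * s + β * t
    weighted-interchange-≤ {x₁} {x₂} {y₁} {y₂} {s} {t} h₁ h₂ = begin
      α * (α * x₁ + β * x₂) + β * (α * y₁ + β * y₂)  ≈⟨ weighted-interchange α β x₁ x₂ y₁ y₂ ⟩
      α * (α * x₁ + β * y₁) + β * (α * x₂ + β * y₂)  ≤⟨ +-mono-≤ (*-monoˡ-≤-nonneg 0≤α h₁) (*-monoˡ-≤-nonneg 0≤β h₂) ⟩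
      α * s + β * t                                  ∎

    σ-nearly-balanced : ∀ {s t} → 1 ≤ s → s ≤ t → t ≤ 2 ℕ.+ s → α * σ s + β * σ t ≤R σ (s ℕ.+ t)
    σ-nearly-balanced {s} {t} 1≤s s≤t t≤2+s with ℕₚ.m≤n⇒m<n∨m≡n s≤t
    ... | inj₂ ≡.refl = ≤R.reflexive (sym (σ-even (positive 1≤s)))
    ... | inj₁ s<t with ℕₚ.m≤n⇒m<n∨m≡n s<t
    ...   | inj₂ ≡.refl = ≤R.reflexive (sym (trans (σ-cong (ℕₚ.+-suc s s)) (σ-odd (positive 1≤s))))
    ...   | inj₁ 1+s<t with ℕₚ.≤-antisym 1+s<t t≤2+s
    ...     | ≡.refl = begin
      α * σ s + β * σ (2 ℕ.+ s)              ≤⟨ σ-concave (positive 1≤s) ⟩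
      α * σ (1 ℕ.+ s) + β * σ (1 ℕ.+ s)      ≈⟨ σ-even-suc (positive 1≤s) ⟨
      σ (2 ℕ.+ (s ℕ.+ s))                    ≈⟨ σ-cong (≡.trans (ℕₚ.+-suc s (suc s)) (cong suc (ℕₚ.+-suc s s))) ⟨
      σ (s ℕ.+ (2 ℕ.+ s))                    ∎

    σ-superadditive : ∀ {k l} → 1 ≤ k → k ≤ l → α * σ k + β * σ l ≤R σ (k ℕ.+ l)
    σ-superadditive {l = l} = <-rec Superadditive step l
      where
      Superadditive : ℕ → Set ℓ₂
      Superadditive l = ∀ {k} → 1 ≤ k → k ≤ l → α * σ k + β * σ l ≤R σ (k ℕ.+ l)

      step : ∀ l → (∀ {m} → m < l → Superadditive m) → Superadditive l
      step l             _   {suc zero}    _ 1≤l = σ-superadditive-1 (positive 1≤l)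
      step l@(suc (suc l′)) rec {k@(suc (suc _))} _ k≤l = begin
        α * σ k + β * σ l
          ≈⟨ +-cong (*-congˡ (σ-halves 2≤k)) (*-congˡ (σ-halves 2≤l)) ⟩
        α * (α * σ ⌊ k /2⌋ + β * σ ⌈ k /2⌉) + β * (α * σ ⌊ l /2⌋ + β * σ ⌈ l /2⌉)
          ≤⟨ weighted-interchange-≤ (rec (ℕₚ.⌊n/2⌋<n (suc l′)) (s≤s z≤n) (ℕₚ.⌊n/2⌋-mono k≤l))
                                    (rec (ℕₚ.⌈n/2⌉<n l′) (s≤s z≤n) (ℕₚ.⌈n/2⌉-mono k≤l)) ⟩
        α * σ (⌊ k /2⌋ ℕ.+ ⌊ l /2⌋) + β * σ (⌈ k /2⌉ ℕ.+ ⌈ l /2⌉)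
          ≤⟨ σ-nearly-balanced (ℕₚ.≤-trans (s≤s z≤n) (ℕₚ.m≤m+n ⌊ k /2⌋ ⌊ l /2⌋)) (⌊⌋-sum≤⌈⌉-sum k l) (⌈⌉-sum≤2+⌊⌋-sum k l) ⟩
        σ ((⌊ k /2⌋ ℕ.+ ⌊ l /2⌋) ℕ.+ (⌈ k /2⌉ ℕ.+ ⌈ l /2⌉))
          ≈⟨ σ-cong (halves-sum k l) ⟩
        σ (k ℕ.+ l)
          ∎
        where
        2≤k : 2 ≤ k
        2≤k = s≤s (s≤s z≤n)
        2≤l : 2 ≤ l
        2≤l = s≤s (s≤s z≤n)
      step zero          _ {suc (suc _)} _ ()
      step (suc zero)    _ {suc (suc _)} _ (s≤s ())

    module MaximumRecurrence
      (u : ℕ → Carrier) (u-1 : u 1 ≈ 1#)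
      (u-upper : ∀ n → 2 ≤ n → ∀ k → 1 ≤ k → k ≤ ⌊ n /2⌋ → α * u k + β * u (n ∸ k) ≤R u n)
      (u-attained : ∀ n → 2 ≤ n → Σ ℕ λ k → 1 ≤ k × k ≤ ⌊ n /2⌋ × u n ≈ α * u k + β * u (n ∸ k))
      where

      u≈σ : ∀ n → 1 ≤ n → u n ≈ σ n
      u≈σ = <-rec AgreesWithσ step
        where
        AgreesWithσ : ℕ → Set ℓ₁
        AgreesWithσ n = 1 ≤ n → u n ≈ σ n

        step : ∀ n → (∀ {m} → m < n → AgreesWithσ m) → AgreesWithσ n
        step (suc zero)         _  _ = u-1
        step n@(suc (suc n′)) ih _ with u-attained n (s≤s (s≤s z≤n))
        ... | k , 1≤k , k≤⌊n/2⌋ , u-n≈ = ≤R.antisym upper lower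
          where
          u≈σ-pair : ∀ {j} → 1 ≤ j → j ≤ ⌊ n /2⌋ → α * u j + β * u (n ∸ j) ≈ α * σ j + β * σ (n ∸ j)
          u≈σ-pair {j} 1≤j j≤⌊n/2⌋ = +-cong (*-congˡ (ih j<n 1≤j)) (*-congˡ (ih n∸j<n 1≤n∸j))
            where
            j<n : j < n
            j<n = ℕₚ.≤-<-trans j≤⌊n/2⌋ (ℕₚ.⌊n/2⌋<n (suc n′))
            n∸j<n : n ∸ j < n
            n∸j<n = ℕₚ.∸-monoʳ-< 1≤j (ℕₚ.<⇒≤ j<n)
            1≤n∸j : 1 ≤ n ∸ j
            1≤n∸j = ℕₚ.≤-trans 1≤j (m≤⌊n/2⌋⇒m≤n∸m j≤⌊n/2⌋)

          upper : u n ≤R σ n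
          upper = begin
            u n                      ≈⟨ u-n≈ ⟩
            α * u k + β * u (n ∸ k)  ≈⟨ u≈σ-pair 1≤k k≤⌊n/2⌋ ⟩
            α * σ k + β * σ (n ∸ k)  ≤⟨ σ-superadditive 1≤k (m≤⌊n/2⌋⇒m≤n∸m k≤⌊n/2⌋) ⟩
            σ (k ℕ.+ (n ∸ k))        ≈⟨ σ-cong (ℕₚ.m+[n∸m]≡n (ℕₚ.≤-trans k≤⌊n/2⌋ (ℕₚ.⌊n/2⌋≤n n))) ⟩
            σ n                      ∎

          lower : σ n ≤R u n
          lower = begin
            σ n                                  ≈⟨ σ-halves {n} (s≤s (s≤s z≤n)) ⟩
            α * σ ⌊ n /2⌋ + β * σ ⌈ n /2⌉        ≈⟨ +-congˡ (*-congˡ (σ-cong (n∸⌊n/2⌋≡⌈n/2⌉ n))) ⟨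
            α * σ ⌊ n /2⌋ + β * σ (n ∸ ⌊ n /2⌋)  ≈⟨ u≈σ-pair (s≤s z≤n) ℕₚ.≤-refl ⟨
            α * u ⌊ n /2⌋ + β * u (n ∸ ⌊ n /2⌋)  ≤⟨ u-upper n (s≤s (s≤s z≤n)) ⌊ n /2⌋ (s≤s z≤n) ℕₚ.≤-refl ⟩
            u n                                  ∎

      u-halves : ∀ n → 2 ≤ n → u n ≈ α * u ⌊ n /2⌋ + β * u ⌈ n /2⌉
      u-halves n 2≤n = begin-equality
        u n                            ≈⟨ u≈σ n (ℕₚ.≤-trans (s≤s z≤n) 2≤n) ⟩
        σ n                            ≈⟨ σ-halves 2≤n ⟩
        α * σ ⌊ n /2⌋ + β * σ ⌈ n /2⌉  ≈⟨ +-cong (*-congˡ (u≈σ _ (ℕₚ.⌊n/2⌋-mono 2≤n)))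
                                                 (*-congˡ (u≈σ _ (ℕₚ.⌈n/2⌉-mono (ℕₚ.≤-trans (s≤s z≤n) 2≤n)))) ⟨
        α * u ⌊ n /2⌋ + β * u ⌈ n /2⌉  ∎

      max-at-⌊n/2⌋ : ∀ n → 2 ≤ n → u n ≈ α * u ⌊ n /2⌋ + β * u (n ∸ ⌊ n /2⌋)
      max-at-⌊n/2⌋ n 2≤n = trans (u-halves n 2≤n) (+-congˡ (*-congˡ (reflexive (cong u (≡.sym (n∸⌊n/2⌋≡⌈n/2⌉ n))))))

propositionC3 : ∀ {c ℓ₁ ℓ₂} (R : OrderedCommutativeRing c ℓ₁ ℓ₂) →
    let open OrderedCommutativeRing R renaming (_≤_ to _≤R_) in
    (α β : Carrier) → 0# < α → 0# < β → β ≤R α → β ≤R 1# → 1# ≤R (α + β) →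
    (u : ℕ → Carrier) → u 1 ≈ 1# →
    -- u(n) is the maximum of α u(k) + β u(n-k) over 1 ≤ k ≤ ⌊n/2⌋:
    (∀ n → 2 ≤ n → ∀ k → 1 ≤ k → k ≤ ⌊ n /2⌋ → ((α * u k) + (β * u (n ∸ k))) ≤R u n) →
    (∀ n → 2 ≤ n → Σ ℕ (λ k → (1 ≤ k) × (k ≤ ⌊ n /2⌋) × (u n ≈ ((α * u k) + (β * u (n ∸ k)))))) →
    -- conclusion: maximum attained at k = ⌊n/2⌋, and u = S_{α,β}
    (∀ n → 2 ≤ n → u n ≈ ((α * u ⌊ n /2⌋) + (β * u (n ∸ ⌊ n /2⌋))))
    × (∀ n → 2 ≤ n → u n ≈ ((α * u ⌊ n /2⌋) + (β * u ⌈ n /2⌉)))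
    × (∀ n → 1 ≤ n → u n ≈ S R α β n)
propositionC3 R α β 0<α 0<β β≤α β≤1 1≤α+β u u-1 u-upper u-attained = max-at-⌊n/2⌋ , u-halves , u≈σ
  where
  open SRecurrence.Inequalities.MaximumRecurrence R α β (proj₁ 0<α) (proj₁ 0<β) β≤α β≤1 1≤α+β u u-1 u-upper u-attained
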